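{- Let $p\ge1$, $s\ge0$, $k\ge1$, and let $p_1,\dots,p_k,s_1,\dots,s_k$ be integers with $0\le p_i<p$ and $s_i\ge s$. Let $\bar s=\max_is_i$ and $n\ge\max(1,2\bar s)$. (a) If $T\subseteq\widehat E_C(n)$ is a cycle-cover of $\widehat C_n=(\widehat V(n),\widehat E_C(n))$, then $T\setminus\mathrm{Hook}(n)$ is a legal cover of $L_n$. (b) If $T\subseteq\widehat E_L(n+1)$ is a legal cover of $L_{n+1}$, then $T\setminus\mathrm{New}(n)$ is a legal cover of $L_n$.
   Context: $\widehat V(n)=\{(u,v):0\le u\le p-2,0\le v\le n-1\}\cup\{(p-1,v):0\le v\le n+s-1\}$ and $f(n;u,v)=un+v$. $\widehat E_C(n)$ consists of the pairs $((u_1,v_1),(u_2,v_2))\in\widehat V(n)^2$ with $f(n;u_2,v_2)-f(n;u_1,v_1)\equiv p_in+s_i\pmod{pn+s}$ for some $i$. $\widehat E_L(n)$ consists of those pairs for which some $i$ satisfies both this congruence and $u_2-u_1\equiv p_i\pmod p$. $L_n=(\widehat V(n),\widehat E_L(n))$. Put $\mathrm{Hook}(n)=\widehat E_C(n)\setminus\widehat E_L(n)$ and $\mathrm{New}(n)=\widehat E_L(n+1)\setminus\widehat E_L(n)$. Let $L(n)=\{(u,v):0\le u\le p-1,0\le v\le\bar s-1\}$ and $R(n)=\{(u,v):0\le u\le p-2,n-\bar s\le v\le n-1\}\cup\{(p-1,v):n+s-\bar s\le v\le n+s-1\}$. $\mathrm{ID}_T,\mathrm{OD}_T$ denote in- and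 out-degree with respect to the edge set $T$. A cycle-cover is an edge set with all in- and out-degrees equal to $1$. A set $T\subseteq\widehat E_L(n)$ is a legal cover of $L_n$ if all in- and out-degrees are $\le1$, $\mathrm{ID}_T(v)=1$ for $v\notin L(n)$, and $\mathrm{OD}_T(v)=1$ for $v\notin R(n)$. -}

module Defs where

open import Level using (0ℓ)
open import Data.Nat using (ℕ; zero; suc; _+_; _*_; _∸_; _≤_; _<_; _⊔_)
open import Data.Fin using (Fin)
import Data.Fin as F
open import Data.Integer using (ℤ; +_) renaming (_+_ to _+ℤ_; _-_ to _-ℤ_; _*_ to _*ℤ_)
open import Data.Integer.Divisibility using (_∣_)
open import Data.Product using (_×_; _,_; ∃; ∃!)
open import Data.Sum using (_⊎_)
open import Relation.Unary using (Pred; _⊆_; _∖_)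
open import Relation.Binary.PropositionalEquality using (_≡_)
import Data.Empty

-- s̄ = max_i s_i  (for k ≥ 1 this is the maximum; empty max is 0)
maxF : ∀ {k} → (Fin k → ℕ) → ℕ
maxF {zero}  f = 0
maxF {suc k} f = f F.zero ⊔ maxF (λ i → f (F.suc i))

Vertex : Set
Vertex = ℕ × ℕ

Edge : Set
Edge = Vertex × Vertex

_≡[_]_ : ℤ → ℕ → ℤ → Set
a ≡[ m ] b = (+ m) ∣ (a -ℤ b)

InDeg≤1 : Pred Edge 0ℓ → Vertex → Set
InDeg≤1 T y = ∀ {a b} → T (a , y) → T (b , y) → a ≡ b

OutDeg≤1 : Pred Edge 0ℓ → Vertex → Set
OutDeg≤1 T x = ∀ {a b} → T (x , a) → T (x , b) → a ≡ b

InDeg≡1 : Pred Edge 0ℓ → Vertex → Set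
InDeg≡1 T y = ∃! _≡_ (λ a → T (a , y))

OutDeg≡1 : Pred Edge 0ℓ → Vertex → Set
OutDeg≡1 T x = ∃! _≡_ (λ a → T (x , a))

module _ (p s : ℕ) {k : ℕ} (ps ss : Fin k → ℕ) where

  sbar : ℕ
  sbar = maxF ss

  V : ℕ → Pred Vertex 0ℓ
  V n (u , v) = (u + 2 ≤ p × v < n) ⊎ (u ≡ p ∸ 1 × v < n + s)

  f : ℕ → Vertex → ℤ
  f n (u , v) = + (u * n + v)

  CongC : ℕ → Fin k → Edge → Set
  CongC n i (x , y) = (f n y -ℤ f n x) ≡[ p * n + s ] (+ (ps i * n + ss i))

  CongU : Fin k → Edge → Set
  CongU i ((u₁ , _) , (u₂ , _)) = (+ u₂ -ℤ + u₁) ≡[ p ] (+ ps i)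

  EC : ℕ → Pred Edge 0ℓ
  EC n (x , y) = V n x × V n y × ∃ λ i → CongC n i (x , y)

  EL : ℕ → Pred Edge 0ℓ
  EL n (x , y) = V n x × V n y × ∃ λ i → CongC n i (x , y) × CongU i (x , y)

  Hook : ℕ → Pred Edge 0ℓ
  Hook n = EC n ∖ EL n

  New : ℕ → Pred Edge 0ℓ
  New n = EL (suc n) ∖ EL n

  Lset : ℕ → Pred Vertex 0ℓ
  Lset n (u , v) = u < p × v < sbar

  Rset : ℕ → Pred Vertex 0ℓ
  Rset n (u , v) = (u + 2 ≤ p × n ∸ sbar ≤ v × v < n)
                 ⊎ (u ≡ p ∸ 1 × n + s ∸ sbar ≤ v × v < n + s)

  CycleCover : ℕ → Pred Edge 0ℓ → Set
  CycleCover n T = T ⊆ EC n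
                 × (∀ x → V n x → InDeg≡1 T x × OutDeg≡1 T x)

  LegalCover : ℕ → Pred Edge 0ℓ → Set
  LegalCover n T = T ⊆ EL n
                 × (∀ x → InDeg≤1 T x × OutDeg≤1 T x)
                 × (∀ x → V n x → ¬L x → InDeg≡1 T x)
                 × (∀ x → V n x → ¬R x → OutDeg≡1 T x)
    where
    ¬L : Vertex → Set
    ¬L x = Lset n x → Data.Empty.⊥
    ¬R : Vertex → Set
    ¬R x = Rset n x → Data.Empty.⊥

module Submission where

-- Put N = p n + s and number the vertices of  \widehat V(n)  row by row,
-- f(u , v) = u n + v, which maps them into [0, N).  An edge (u₁ , v₁) → (u₂ , v₂)
-- with index i then satisfies  f(y) + j N = f(x) + (p_i n + s_i)  for a carry
-- j ≤ 1 (≡[]-elim, both sides being below 2N), an identity of base-n numerals.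
-- Comparing digits (digits) shows that the edge is a Shift,
-- u₂ + j p = u₁ + p_i  and  v₂ + j s = v₁ + s_i,  unless it carries out of the
-- source row; that cannot happen when the target lies at column ≥ s_i (target
-- outside L) or the source row has room for s_i more columns (source outside R):
-- see no-carry-out and no-wrap.  A Shift satisfies the vertex congruence at
-- every width together with the row congruence, so it is an edge of L_n; this
-- is part (a).  For part (b) the same analysis is run at width n + 1, and
-- source-cell / target-cell show that the other endpoint already lies in the
-- width-n grid.  The degree bookkeeping shared by both parts is restrict.

open import Level using (0ℓ)
open import Data.Empty using (⊥; ⊥-elim)
open import Data.Fin using (Fin)
import Data.Fin as Fin
open import Data.Fin.Properties using (any?)
open import Data.Integer using (_⊖_; ∣_∣) renaming (+_ to pos; _+_ to _+ℤ_; _-_ to _-ℤ_; -_ to -ℤ_)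
import Data.Integer.Properties as ℤ
open import Data.Nat using (ℕ; zero; suc; _+_; _*_; _∸_; _≤_; _<_; z≤n; s≤s; _≤?_; _<?_; _≟_)
open import Data.Nat.Divisibility using (divides) renaming (_∣?_ to _∣ℕ?_)
open import Data.Nat.Properties
open import Data.Nat.Tactic.RingSolver using (solve-∀)
open import Data.Product using (_×_; _,_; ∃; ∃!; proj₁; proj₂; uncurry)
open import Data.Sum using (_⊎_; inj₁; inj₂)
open import Relation.Binary.Definitions using (tri<; tri≈; tri>)
open import Relation.Binary.PropositionalEquality
open import Relation.Nullary using (Dec; yes; no; ¬_)
open import Relation.Nullary.Decidable using (_×-dec_; _⊎-dec_; decidable-stable)
open import Relation.Unary using (Pred; _⊆_; _∖_)

open import Defs

-- ∣ (F - G) - C ∣ = ∣ F ⊖ (G + C) ∣: the integer congruences of the paper are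
-- divisibility statements about distances of natural numbers.
distance : ∀ F G C → ∣ (pos F -ℤ pos G) -ℤ pos C ∣ ≡ ∣ F ⊖ (G + C) ∣
distance F G C = cong ∣_∣ (begin
  (pos F -ℤ pos G) -ℤ pos C          ≡⟨ ℤ.+-assoc (pos F) (-ℤ pos G) (-ℤ pos C) ⟩
  pos F +ℤ (-ℤ pos G +ℤ -ℤ pos C)    ≡⟨ cong (pos F +ℤ_) (ℤ.neg-distrib-+ (pos G) (pos C)) ⟨
  pos F -ℤ pos (G + C)               ≡⟨ ℤ.m-n≡m⊖n F (G + C) ⟩
  F ⊖ (G + C)                        ∎)
  where open ≡-Reasoning

≡[]-intro : ∀ {N F G C} j → F + j * N ≡ G + C → (pos F -ℤ pos G) ≡[ N ] (pos C)
≡[]-intro {N} {F} {G} {C} j F+jN≡G+C = divides j (begin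
  ∣ (pos F -ℤ pos G) -ℤ pos C ∣ ≡⟨ distance F G C ⟩
  ∣ F ⊖ (G + C) ∣               ≡⟨ cong (λ H → ∣ F ⊖ H ∣) F+jN≡G+C ⟨
  ∣ F ⊖ (F + j * N) ∣           ≡⟨ ℤ.∣⊖∣-≤ (m≤m+n F (j * N)) ⟩
  F + j * N ∸ F                 ≡⟨ m+n∸m≡n F (j * N) ⟩
  j * N                         ∎)
  where open ≡-Reasoning

≡[]-elim : ∀ {N F G C} → F < N → G + C < N + N → (pos F -ℤ pos G) ≡[ N ] (pos C)
         → ∃ λ j → j ≤ 1 × F + j * N ≡ G + C
≡[]-elim {N} {F} {G} {C} F<N H<2N (divides q d≡qN) with G + C ≤? F
... | yes H≤F = 0 , z≤n , trans (+-identityʳ F) (≤-antisym (m∸n≡0⇒m≤n F∸H≡0) H≤F)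
  where
  F∸H≡qN : F ∸ (G + C) ≡ q * N
  F∸H≡qN = trans (sym (trans (ℤ.∣m⊖n∣≡∣n⊖m∣ F (G + C)) (ℤ.∣⊖∣-≤ H≤F)))
                 (trans (sym (distance F G C)) d≡qN)
  q≡0 : q ≡ 0
  q≡0 = n<1⇒n≡0 (*-cancelʳ-< N q 1
          (≤-<-trans (subst (_≤ F) F∸H≡qN (m∸n≤m F (G + C))) (subst (F <_) (sym (+-identityʳ N)) F<N)))
  F∸H≡0 : F ∸ (G + C) ≡ 0
  F∸H≡0 = trans F∸H≡qN (cong (_* N) q≡0)
... | no H≰F = q , m<1+n⇒m≤n q<2 , trans (cong (F +_) (sym H∸F≡qN)) (m+[n∸m]≡n (<⇒≤ F<H))
  where
  F<H : F < G + C
  F<H = ≰⇒> H≰F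
  H∸F≡qN : G + C ∸ F ≡ q * N
  H∸F≡qN = trans (sym (ℤ.∣⊖∣-< F<H)) (trans (sym (distance F G C)) d≡qN)
  q<2 : q < 2
  q<2 = *-cancelʳ-< N q 2 (≤-<-trans (subst (_≤ G + C) H∸F≡qN (m∸n≤m (G + C) F))
                                     (subst (G + C <_) (sym (cong (N +_) (+-identityʳ N))) H<2N))

borrow : ∀ {m U W A B} → U * m + W ≡ A * m + B → A < U → m + W ≤ B
borrow {m} {U} {W} {A} {B} eq A<U with m≤n⇒∃[o]m+o≡n A<U
... | o , refl = subst (m + W ≤_) low≡B (+-monoʳ-≤ m (m≤n+m W (o * m)))
  where
  shape : ∀ A o m W → (suc A + o) * m + W ≡ A * m + (m + (o * m + W))
  shape = solve-∀
  low≡B : m + (o * m + W) ≡ B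
  low≡B = +-cancelˡ-≡ (A * m) _ _ (trans (sym (shape A o m W)) eq)

digits : ∀ {m U W A B} → U * m + W ≡ A * m + B
       → (A < U → m + W ≤ B → ⊥) → (U < A → m + B ≤ W → ⊥) → U ≡ A × W ≡ B
digits {m} {U} {W} {A} {B} eq carry wrap with <-cmp U A
... | tri< U<A _ _ = ⊥-elim (wrap U<A (borrow (sym eq) U<A))
... | tri> _ _ A<U = ⊥-elim (carry A<U (borrow eq A<U))
... | tri≈ _ U≡A _ = U≡A , +-cancelˡ-≡ (A * m) W B (subst (λ X → X * m + W ≡ A * m + B) U≡A eq)

regroup-carry : ∀ p s u v j m → u * m + v + j * (p * m + s) ≡ (u + j * p) * m + (v + j * s)
regroup-carry = solve-∀

regroup : ∀ u v a b m → u * m + v + (a * m + b) ≡ (u + a) * m + (v + b)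
regroup = solve-∀

-- The grid with p rows, the last of which is s columns longer than the others,
-- at every width m.
module Grid (p s : ℕ) where

  Fits : ℕ → ℕ → ℕ → Set
  Fits m u v = v < m + s × (u + 2 ≤ p → v < m)

  Cell : ℕ → Vertex → Set
  Cell m (u , v) = u < p × Fits m u v

  short⇒< : ∀ {u} → u + 2 ≤ p → suc u < p
  short⇒< {u} = subst (_≤ p) (+-comm u 2)

  long-row : ∀ {u} → ¬ (u + 2 ≤ p) → p ≤ suc u
  long-row {u} ¬short = ≤-pred (subst (suc p ≤_) (+-comm u 2) (≰⇒> ¬short))

  last-row : ∀ {m u v} → Fits m u v → m ≤ v → p ≤ suc u
  last-row (_ , short) m≤v = long-row (λ u+2≤p → <⇒≱ (short u+2≤p) m≤v)

  fits-mono : ∀ {m u v} → Fits m u v → Fits (suc m) u v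
  fits-mono (v<m+s , short) = m<n⇒m<1+n v<m+s , λ u+2≤p → m<n⇒m<1+n (short u+2≤p)

  digit-bound : ∀ {m a b} → a < p → b < m → a * m + b < p * m + s
  digit-bound {m} {a} {b} a<p b<m = begin-strict
    a * m + b   <⟨ +-monoʳ-< (a * m) b<m ⟩
    a * m + m   ≡⟨ +-comm (a * m) m ⟩
    suc a * m   ≤⟨ *-monoˡ-≤ m a<p ⟩
    p * m       ≤⟨ m≤m+n (p * m) s ⟩
    p * m + s   ∎
    where open ≤-Reasoning

  cell-bound : ∀ {m u v} → Cell m (u , v) → u * m + v < p * m + s
  cell-bound {m} {u} {v} (u<p , v<m+s , short) with u + 2 ≤? p
  ... | yes u+2≤p = digit-bound u<p (short u+2≤p)
  ... | no ¬short = begin-strict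
    u * m + v         <⟨ +-monoʳ-< (u * m) v<m+s ⟩
    u * m + (m + s)   ≡⟨ +-assoc (u * m) m s ⟨
    u * m + m + s     ≡⟨ cong (_+ s) (+-comm (u * m) m) ⟩
    suc u * m + s     ≡⟨ cong (λ r → r * m + s) (≤-antisym u<p (long-row ¬short)) ⟩
    p * m + s         ∎
    where open ≤-Reasoning

  -- The edge (u₁ , v₁) → (u₂ , v₂) moves a rows down and b columns right,
  -- where a carry j wraps around the p rows at the cost of s columns.
  data Shift (a b : ℕ) : Vertex → Vertex → Set where
    shift : ∀ {u₁ v₁ u₂ v₂} j → j ≤ 1 → u₂ + j * p ≡ u₁ + a → v₂ + j * s ≡ v₁ + b
          → Shift a b (u₁ , v₁) (u₂ , v₂)

  no-carry-out : ∀ {m a u₁ u₂ K j} → j ≤ 1 → u₂ < p → Fits m u₁ K → m + j * s ≤ K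
               → u₁ + a < u₂ + j * p → ⊥
  no-carry-out {m} {a} {u₁} {u₂} z≤n u₂<p fits m+0≤K overshoot = <⇒≱ overshoot (begin
    u₂ + 0   ≡⟨ +-identityʳ u₂ ⟩
    u₂       ≤⟨ m<1+n⇒m≤n (<-≤-trans u₂<p (last-row fits (≤-trans (m≤m+n m 0) m+0≤K))) ⟩
    u₁       ≤⟨ m≤m+n u₁ a ⟩
    u₁ + a   ∎)
    where open ≤-Reasoning
  no-carry-out {m} {K = K} (s≤s z≤n) _ (K<m+s , _) m+s≤K _ =
    <⇒≱ K<m+s (subst (λ t → m + t ≤ K) (+-identityʳ s) m+s≤K)

  -- The row index cannot undershoot (wrap around too far) when s ≤ b: the
  -- target column would exceed the grid, or the target row the last row.
  no-wrap : ∀ {m a b u₁ v₁ u₂ v₂ j} → j ≤ 1 → a < p → s ≤ b → u₁ < p → Fits m u₂ v₂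
          → u₂ + j * p < u₁ + a → m + (v₁ + b) ≤ v₂ + j * s → ⊥
  no-wrap {m} {a} {b} {u₁} {v₁} {u₂} {v₂} z≤n _ s≤b _ (v₂<m+s , _) _ far = <⇒≱ v₂<m+s (begin
    m + s          ≤⟨ +-monoʳ-≤ m (≤-trans s≤b (m≤n+m b v₁)) ⟩
    m + (v₁ + b)   ≤⟨ far ⟩
    v₂ + 0         ≡⟨ +-identityʳ v₂ ⟩
    v₂             ∎)
    where open ≤-Reasoning
  no-wrap {m} {a} {b} {u₁} {v₁} {u₂} {v₂} (s≤s z≤n) a<p s≤b u₁<p fits undershoot far =
    <⇒≱ (+-mono-< (n<1+n u₁) (n<1+n a)) (begin
      suc u₁ + suc a       ≤⟨ +-mono-≤ u₁<p a<p ⟩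
      p + p                ≤⟨ +-monoˡ-≤ p (last-row fits m≤v₂) ⟩
      suc u₂ + p           ≡⟨ cong (λ t → suc u₂ + t) (+-identityʳ p) ⟨
      suc (u₂ + (p + 0))   ≤⟨ undershoot ⟩
      u₁ + a               ∎)
    where
    open ≤-Reasoning
    m≤v₂ : m ≤ v₂
    m≤v₂ = +-cancelʳ-≤ s m v₂ (begin
      m + s          ≤⟨ +-monoʳ-≤ m (≤-trans s≤b (m≤n+m b v₁)) ⟩
      m + (v₁ + b)   ≤⟨ far ⟩
      v₂ + (s + 0)   ≡⟨ cong (v₂ +_) (+-identityʳ s) ⟩
      v₂ + s         ∎)

  carry≤s : ∀ {j} → j ≤ 1 → j * s ≤ s
  carry≤s z≤n = z≤n
  carry≤s (s≤s z≤n) = ≤-reflexive (+-identityʳ s)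

  Congruent : ℕ → ℕ → ℕ → Vertex → Vertex → Set
  Congruent m a b (u₁ , v₁) (u₂ , v₂) =
    (pos (u₂ * m + v₂) -ℤ pos (u₁ * m + v₁)) ≡[ p * m + s ] pos (a * m + b)

  congruent⇒shift : ∀ {m a b u₁ v₁ u₂ v₂} → a < p → b < m → s ≤ b
    → Cell m (u₁ , v₁) → Cell m (u₂ , v₂) → Congruent m a b (u₁ , v₁) (u₂ , v₂)
    → b ≤ v₂ ⊎ Fits m u₁ (v₁ + b)
    → Shift a b (u₁ , v₁) (u₂ , v₂)
  congruent⇒shift {m} {a} {b} {u₁} {v₁} {u₂} {v₂} a<p b<m s≤b x y congruent room
    with ≡[]-elim {G = u₁ * m + v₁} {C = a * m + b}
                  (cell-bound y) (+-mono-< (cell-bound x) (digit-bound a<p b<m)) congruent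
  ... | j , j≤1 , eq = uncurry (shift j j≤1) (digits digit-eq (carry-out room) wrap)
    where
    digit-eq : (u₂ + j * p) * m + (v₂ + j * s) ≡ (u₁ + a) * m + (v₁ + b)
    digit-eq = trans (sym (regroup-carry p s u₂ v₂ j m)) (trans eq (regroup u₁ v₁ a b m))
    carry-out : b ≤ v₂ ⊎ Fits m u₁ (v₁ + b)
              → u₁ + a < u₂ + j * p → m + (v₂ + j * s) ≤ v₁ + b → ⊥
    carry-out (inj₂ fits) overshoot far =
      no-carry-out j≤1 (proj₁ y) fits (≤-trans (+-monoʳ-≤ m (m≤n+m (j * s) v₂)) far) overshoot
    carry-out (inj₁ b≤v₂) overshoot far = no-carry-out j≤1 (proj₁ y) (proj₂ x) m+js≤v₁ overshoot
      where
      open ≤-Reasoning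
      m+js≤v₁ : m + j * s ≤ v₁
      m+js≤v₁ = +-cancelʳ-≤ b (m + j * s) v₁ (begin
        m + j * s + b     ≡⟨ +-assoc m (j * s) b ⟩
        m + (j * s + b)   ≤⟨ +-monoʳ-≤ m (+-monoʳ-≤ (j * s) b≤v₂) ⟩
        m + (j * s + v₂)  ≡⟨ cong (m +_) (+-comm (j * s) v₂) ⟩
        m + (v₂ + j * s)  ≤⟨ far ⟩
        v₁ + b            ∎)
    wrap : u₂ + j * p < u₁ + a → m + (v₁ + b) ≤ v₂ + j * s → ⊥
    wrap = no-wrap j≤1 a<p s≤b (proj₁ x) (proj₂ y)

  shift⇒congruent : ∀ {a b x y} → Shift a b x y → ∀ m → Congruent m a b x y
  shift⇒congruent {a} {b} (shift {u₁} {v₁} {u₂} {v₂} j _ eu ev) m =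
    ≡[]-intro {G = u₁ * m + v₁} {C = a * m + b} j (begin
      u₂ * m + v₂ + j * (p * m + s)     ≡⟨ regroup-carry p s u₂ v₂ j m ⟩
      (u₂ + j * p) * m + (v₂ + j * s)   ≡⟨ cong₂ (λ U W → U * m + W) eu ev ⟩
      (u₁ + a) * m + (v₁ + b)           ≡⟨ regroup u₁ v₁ a b m ⟨
      u₁ * m + v₁ + (a * m + b)         ∎)
    where open ≡-Reasoning

  shift⇒row-congruent : ∀ {a b u₁ v₁ u₂ v₂} → Shift a b (u₁ , v₁) (u₂ , v₂)
                      → (pos u₂ -ℤ pos u₁) ≡[ p ] pos a
  shift⇒row-congruent {a} {u₁ = u₁} (shift j _ eu _) = ≡[]-intro {G = u₁} {C = a} j eu

  source-cell : ∀ {n a b u₁ v₁ u₂ v₂} → a < p → s ≤ b → Shift a b (u₁ , v₁) (u₂ , v₂)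
              → u₁ < p → Cell n (u₂ , v₂) → Cell n (u₁ , v₁)
  source-cell {n} {a} {b} {u₁} {v₁} {u₂} {v₂} a<p s≤b (shift j j≤1 eu ev) u₁<p (u₂<p , v₂<n+s , short₂) =
    u₁<p , ≤-<-trans v₁≤v₂ v₂<n+s , short₁
    where
    open ≤-Reasoning
    v₁≤v₂ : v₁ ≤ v₂
    v₁≤v₂ = +-cancelʳ-≤ b v₁ v₂ (begin
      v₁ + b      ≡⟨ ev ⟨
      v₂ + j * s  ≤⟨ +-monoʳ-≤ v₂ (≤-trans (carry≤s j≤1) s≤b) ⟩
      v₂ + b      ∎)
    short₁ : u₁ + 2 ≤ p → v₁ < n
    short₁ u₁+2≤p with u₂ + 2 ≤? p
    ... | yes u₂+2≤p = ≤-<-trans v₁≤v₂ (short₂ u₂+2≤p)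
    ... | no ¬short = by-carry j≤1 eu ev
      where
      by-carry : ∀ {j} → j ≤ 1 → u₂ + j * p ≡ u₁ + a → v₂ + j * s ≡ v₁ + b → v₁ < n
      by-carry z≤n _ ev₀ = +-cancelʳ-< b v₁ n (begin-strict
        v₁ + b   ≡⟨ ev₀ ⟨
        v₂ + 0   ≡⟨ +-identityʳ v₂ ⟩
        v₂       <⟨ v₂<n+s ⟩
        n + s    ≤⟨ +-monoʳ-≤ n s≤b ⟩
        n + b    ∎)
      by-carry (s≤s z≤n) eu₁ _ = ⊥-elim (<-irrefl refl (begin-strict
        suc (u₁ + a)         <⟨ +-mono-< (short⇒< u₁+2≤p) a<p ⟩
        p + p                ≤⟨ +-monoˡ-≤ p (long-row ¬short) ⟩
        suc u₂ + p           ≡⟨ cong (λ t → suc u₂ + t) (+-identityʳ p) ⟨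
        suc (u₂ + (p + 0))   ≡⟨ cong suc eu₁ ⟩
        suc (u₁ + a)         ∎))

  target-cell : ∀ {n a b u₁ v₁ u₂ v₂} → Shift a b (u₁ , v₁) (u₂ , v₂)
              → u₂ < p → Fits n u₁ (v₁ + b) → Cell n (u₂ , v₂)
  target-cell {n} {a} {b} {u₁} {v₁} {u₂} {v₂} (shift j j≤1 eu ev) u₂<p (room , short-room) =
    u₂<p , ≤-<-trans v₂≤v₁+b room , short₂
    where
    open ≤-Reasoning
    v₂≤v₁+b : v₂ ≤ v₁ + b
    v₂≤v₁+b = subst (v₂ ≤_) ev (m≤m+n v₂ (j * s))
    short₂ : u₂ + 2 ≤ p → v₂ < n
    short₂ u₂+2≤p with u₁ + 2 ≤? p
    ... | yes u₁+2≤p = ≤-<-trans v₂≤v₁+b (short-room u₁+2≤p)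
    ... | no ¬short = by-carry j≤1 eu ev
      where
      by-carry : ∀ {j} → j ≤ 1 → u₂ + j * p ≡ u₁ + a → v₂ + j * s ≡ v₁ + b → v₂ < n
      by-carry z≤n eu₀ _ = ⊥-elim (<⇒≱ (short⇒< u₂+2≤p) (begin
        p              ≤⟨ long-row ¬short ⟩
        suc u₁         ≤⟨ s≤s (m≤m+n u₁ a) ⟩
        suc (u₁ + a)   ≡⟨ cong suc eu₀ ⟨
        suc (u₂ + 0)   ≡⟨ cong suc (+-identityʳ u₂) ⟩
        suc u₂         ∎))
      by-carry (s≤s z≤n) _ ev₁ = +-cancelʳ-< s v₂ n (begin-strict
        v₂ + s         ≡⟨ cong (v₂ +_) (+-identityʳ s) ⟨
        v₂ + (s + 0)   ≡⟨ ev₁ ⟩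
        v₁ + b         <⟨ room ⟩
        n + s          ∎)

maxF-upper : ∀ {k} (g : Fin k → ℕ) i → g i ≤ maxF g
maxF-upper g Fin.zero    = m≤m⊔n _ _
maxF-upper g (Fin.suc i) = ≤-trans (maxF-upper (λ j → g (Fin.suc j)) i) (m≤n⊔m _ _)

unique⇒≤1 : ∀ {P : Vertex → Set} → ∃! _≡_ P → ∀ {a b} → P a → P b → a ≡ b
unique⇒≤1 (_ , _ , unique) Pa Pb = trans (sym (unique Pa)) (unique Pb)

unique-∩ : ∀ {P Q : Vertex → Set} → ∃! _≡_ P → (∀ {a} → P a → Q a) → ∃! _≡_ (λ a → P a × Q a)
unique-∩ (a , Pa , unique) P⊆Q = a , (Pa , P⊆Q Pa) , λ PQb → unique (proj₁ PQb)

half< : ∀ {b n} → 1 ≤ n → 2 * b ≤ n → b < n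
half< {zero}  1≤n _    = 1≤n
half< {suc b} _   2b≤n = <-≤-trans (m<m+n (suc b) {suc b + 0} (s≤s z≤n)) 2b≤n

module Covers (p s : ℕ) {k : ℕ} (ps ss : Fin k → ℕ) (1≤p : 1 ≤ p)
              (ps<p : ∀ i → ps i < p) (s≤ss : ∀ i → s ≤ ss i) where

  open Grid p s

  s̄ : ℕ
  s̄ = sbar p s ps ss

  ss≤s̄ : ∀ i → ss i ≤ s̄
  ss≤s̄ = maxF-upper ss

  V⇒cell : ∀ {m u v} → V p s ps ss m (u , v) → Cell m (u , v)
  V⇒cell (inj₁ (u+2≤p , v<m)) = <⇒≤ (short⇒< u+2≤p) , m≤n⇒m≤n+o s v<m , λ _ → v<m
  V⇒cell (inj₂ (refl , v<m+s)) =
    ≤-reflexive last , v<m+s , λ short → ⊥-elim (<-irrefl refl (subst (_< p) last (short⇒< short)))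
    where
    last : suc (p ∸ 1) ≡ p
    last = trans (+-comm 1 (p ∸ 1)) (m∸n+n≡m 1≤p)

  cell⇒V : ∀ {m u v} → Cell m (u , v) → V p s ps ss m (u , v)
  cell⇒V {u = u} (u<p , v<m+s , short) with u + 2 ≤? p
  ... | yes u+2≤p = inj₁ (u+2≤p , short u+2≤p)
  ... | no ¬short = inj₂ (cong (_∸ 1) (≤-antisym u<p (long-row ¬short)) , v<m+s)

  V-mono : ∀ {m x} → V p s ps ss m x → V p s ps ss (suc m) x
  V-mono (inj₁ (u+2≤p , v<m))  = inj₁ (u+2≤p , m<n⇒m<1+n v<m)
  V-mono (inj₂ (u≡p∸1 , v<m+s)) = inj₂ (u≡p∸1 , m<n⇒m<1+n v<m+s)

  ¬L⇒s̄≤ : ∀ {m u v} → V p s ps ss m (u , v) → ¬ Lset p s ps ss m (u , v) → s̄ ≤ v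
  ¬L⇒s̄≤ x ¬L = ≮⇒≥ (λ v<s̄ → ¬L (proj₁ (V⇒cell x) , v<s̄))

  ¬R⇒room : ∀ {m u v b} → Cell m (u , v) → ¬ Rset p s ps ss m (u , v) → b ≤ s̄ → s̄ ≤ m
          → Fits m u (v + b)
  ¬R⇒room {m} {u} {v} {b} (u<p , v<m+s , short) ¬R b≤s̄ s̄≤m = room , short-room
    where
    gap : ∀ {c} → s̄ ≤ c → ¬ (c ∸ s̄ ≤ v) → v + b < c
    gap {c} s̄≤c ¬c∸s̄≤v =
      ≤-<-trans (+-monoʳ-≤ v b≤s̄) (subst (v + s̄ <_) (m∸n+n≡m s̄≤c) (+-monoˡ-< s̄ (≰⇒> ¬c∸s̄≤v)))
    short-room : u + 2 ≤ p → v + b < m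
    short-room u+2≤p = gap s̄≤m (λ m∸s̄≤v → ¬R (inj₁ (u+2≤p , m∸s̄≤v , short u+2≤p)))
    room : v + b < m + s
    room with u + 2 ≤? p
    ... | yes u+2≤p = m≤n⇒m≤n+o s (short-room u+2≤p)
    ... | no ¬short = gap (m≤n⇒m≤n+o s s̄≤m) λ m+s∸s̄≤v →
      ¬R (inj₂ (cong (_∸ 1) (≤-antisym u<p (long-row ¬short)) , m+s∸s̄≤v , v<m+s))

  -- R grows to the right with the width, so leaving R(m) means leaving R(m+1).
  ¬R-mono : ∀ {m u v} → Cell m (u , v) → ¬ Rset p s ps ss m (u , v) → ¬ Rset p s ps ss (suc m) (u , v)
  ¬R-mono {m} (_ , v<m+s , short) ¬R (inj₁ (u+2≤p , m+1∸s̄≤v , _)) =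
    ¬R (inj₁ (u+2≤p , ≤-trans (∸-monoˡ-≤ s̄ (n≤1+n m)) m+1∸s̄≤v , short u+2≤p))
  ¬R-mono {m} (_ , v<m+s , _) ¬R (inj₂ (u≡p∸1 , m+1+s∸s̄≤v , _)) =
    ¬R (inj₂ (u≡p∸1 , ≤-trans (∸-monoˡ-≤ s̄ (n≤1+n (m + s))) m+1+s∸s̄≤v , v<m+s))

  edge-shift : ∀ {m u₁ v₁ u₂ v₂} i → s̄ < m → Cell m (u₁ , v₁) → Cell m (u₂ , v₂)
             → CongC p s ps ss m i ((u₁ , v₁) , (u₂ , v₂))
             → ss i ≤ v₂ ⊎ Fits m u₁ (v₁ + ss i)
             → Shift (ps i) (ss i) (u₁ , v₁) (u₂ , v₂)
  edge-shift i s̄<m = congruent⇒shift (ps<p i) (≤-<-trans (ss≤s̄ i) s̄<m) (s≤ss i)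

  shift⇒EL : ∀ {n u₁ v₁ u₂ v₂} i → V p s ps ss n (u₁ , v₁) → V p s ps ss n (u₂ , v₂)
           → Shift (ps i) (ss i) (u₁ , v₁) (u₂ , v₂) → EL p s ps ss n ((u₁ , v₁) , (u₂ , v₂))
  shift⇒EL {n} i x y sh = x , y , i , shift⇒congruent sh n , shift⇒row-congruent sh

  hookless-in : ∀ {n u₁ v₁ u₂ v₂} → s̄ < n → EC p s ps ss n ((u₁ , v₁) , (u₂ , v₂))
              → ¬ Lset p s ps ss n (u₂ , v₂) → EL p s ps ss n ((u₁ , v₁) , (u₂ , v₂))
  hookless-in s̄<n (x , y , i , congruent) ¬L =
    shift⇒EL i x y (edge-shift i s̄<n (V⇒cell x) (V⇒cell y) congruent
                      (inj₁ (≤-trans (ss≤s̄ i) (¬L⇒s̄≤ y ¬L))))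

  hookless-out : ∀ {n u₁ v₁ u₂ v₂} → s̄ < n → EC p s ps ss n ((u₁ , v₁) , (u₂ , v₂))
               → ¬ Rset p s ps ss n (u₁ , v₁) → EL p s ps ss n ((u₁ , v₁) , (u₂ , v₂))
  hookless-out s̄<n (x , y , i , congruent) ¬R =
    shift⇒EL i x y (edge-shift i s̄<n (V⇒cell x) (V⇒cell y) congruent
                      (inj₂ (¬R⇒room (V⇒cell x) ¬R (ss≤s̄ i) (<⇒≤ s̄<n))))

  old-in : ∀ {n u₁ v₁ u₂ v₂} → s̄ < n → EL p s ps ss (suc n) ((u₁ , v₁) , (u₂ , v₂))
         → V p s ps ss n (u₂ , v₂) → ¬ Lset p s ps ss n (u₂ , v₂) → EL p s ps ss n ((u₁ , v₁) , (u₂ , v₂))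
  old-in {n} {u₁} {v₁} {u₂} {v₂} s̄<n (x′ , y′ , i , congruent , _) y ¬L = shift⇒EL i x y sh
    where
    sh : Shift (ps i) (ss i) (u₁ , v₁) (u₂ , v₂)
    sh = edge-shift i (m<n⇒m<1+n s̄<n) (V⇒cell x′) (V⇒cell y′) congruent
           (inj₁ (≤-trans (ss≤s̄ i) (¬L⇒s̄≤ y ¬L)))
    x : V p s ps ss n (u₁ , v₁)
    x = cell⇒V (source-cell (ps<p i) (s≤ss i) sh (proj₁ (V⇒cell x′)) (V⇒cell y))

  old-out : ∀ {n u₁ v₁ u₂ v₂} → s̄ < n → EL p s ps ss (suc n) ((u₁ , v₁) , (u₂ , v₂))
          → V p s ps ss n (u₁ , v₁) → ¬ Rset p s ps ss n (u₁ , v₁) → EL p s ps ss n ((u₁ , v₁) , (u₂ , v₂))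
  old-out {n} {u₁} {v₁} {u₂} {v₂} s̄<n (x′ , y′ , i , congruent , _) x ¬R = shift⇒EL i x y sh
    where
    room : Fits n u₁ (v₁ + ss i)
    room = ¬R⇒room (V⇒cell x) ¬R (ss≤s̄ i) (<⇒≤ s̄<n)
    sh : Shift (ps i) (ss i) (u₁ , v₁) (u₂ , v₂)
    sh = edge-shift i (m<n⇒m<1+n s̄<n) (V⇒cell x′) (V⇒cell y′) congruent (inj₂ (fits-mono room))
    y : V p s ps ss n (u₂ , v₂)
    y = cell⇒V (target-cell sh (proj₁ (V⇒cell y′)) room)

  -- Membership in L_n is decidable, so an edge of T that is not removed is
  -- in L_n (and not merely not outside it).
  V? : ∀ m x → Dec (V p s ps ss m x)
  V? m (u , v) = ((u + 2 ≤? p) ×-dec (v <? m)) ⊎-dec ((u ≟ p ∸ 1) ×-dec (v <? m + s))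

  EL? : ∀ m e → Dec (EL p s ps ss m e)
  EL? m (x , y) = V? m x ×-dec (V? m y ×-dec any? λ i → (_ ∣ℕ? _) ×-dec (_ ∣ℕ? _))

  -- Both Hook n and New n are of the form D ∖ EL n.
  restrict : ∀ n (D T : Pred Edge 0ℓ) → T ⊆ D
    → (∀ x → InDeg≤1 T x × OutDeg≤1 T x)
    → (∀ y → V p s ps ss n y → ¬ Lset p s ps ss n y
         → InDeg≡1 T y × (∀ {x} → T (x , y) → EL p s ps ss n (x , y)))
    → (∀ x → V p s ps ss n x → ¬ Rset p s ps ss n x
         → OutDeg≡1 T x × (∀ {y} → T (x , y) → EL p s ps ss n (x , y)))
    → LegalCover p s ps ss n (T ∖ (D ∖ EL p s ps ss n))
  restrict n D T T⊆D deg≤1 in-edge out-edge = Kept⊆EL , Kept-deg≤1 , Kept-in , Kept-out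
    where
    Removed Kept : Pred Edge 0ℓ
    Removed = D ∖ EL p s ps ss n
    Kept = T ∖ Removed
    EL⇒¬Removed : ∀ {e} → EL p s ps ss n e → ¬ Removed e
    EL⇒¬Removed e∈EL (_ , e∉EL) = e∉EL e∈EL
    Kept⊆EL : Kept ⊆ EL p s ps ss n
    Kept⊆EL {e} (e∈T , e∉Removed) = decidable-stable (EL? n e) λ e∉EL → e∉Removed (T⊆D e∈T , e∉EL)
    Kept-deg≤1 : ∀ x → InDeg≤1 Kept x × OutDeg≤1 Kept x
    Kept-deg≤1 x = (λ a b → proj₁ (deg≤1 x) (proj₁ a) (proj₁ b))
                 , (λ a b → proj₂ (deg≤1 x) (proj₁ a) (proj₁ b))
    Kept-in : ∀ y → V p s ps ss n y → ¬ Lset p s ps ss n y → InDeg≡1 Kept y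
    Kept-in y y∈V ¬L = unique-∩ (proj₁ (in-edge y y∈V ¬L)) (λ t → EL⇒¬Removed (proj₂ (in-edge y y∈V ¬L) t))
    Kept-out : ∀ x → V p s ps ss n x → ¬ Rset p s ps ss n x → OutDeg≡1 Kept x
    Kept-out x x∈V ¬R = unique-∩ (proj₁ (out-edge x x∈V ¬R)) (λ t → EL⇒¬Removed (proj₂ (out-edge x x∈V ¬R) t))

  hooks-removed : ∀ n → s̄ < n → (T : Pred Edge 0ℓ) → CycleCover p s ps ss n T
                → LegalCover p s ps ss n (T ∖ Hook p s ps ss n)
  hooks-removed n s̄<n T (T⊆EC , deg≡1) = restrict n (EC p s ps ss n) T T⊆EC deg≤1
    (λ y y∈V ¬L → proj₁ (deg≡1 y y∈V) , λ t → hookless-in s̄<n (T⊆EC t) ¬L)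
    (λ x x∈V ¬R → proj₂ (deg≡1 x x∈V) , λ t → hookless-out s̄<n (T⊆EC t) ¬R)
    where
    -- an edge of T joins two vertices, where T has degrees exactly one
    deg≤1 : ∀ x → InDeg≤1 T x × OutDeg≤1 T x
    deg≤1 x = (λ a b → unique⇒≤1 (proj₁ (deg≡1 x (proj₁ (proj₂ (T⊆EC a))))) a b)
            , (λ a b → unique⇒≤1 (proj₂ (deg≡1 x (proj₁ (T⊆EC a)))) a b)

  new-removed : ∀ n → s̄ < n → (T : Pred Edge 0ℓ) → LegalCover p s ps ss (suc n) T
              → LegalCover p s ps ss n (T ∖ New p s ps ss n)
  new-removed n s̄<n T (T⊆EL , deg≤1 , in≡1 , out≡1) = restrict n (EL p s ps ss (suc n)) T T⊆EL deg≤1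
    (λ y y∈V ¬L → in≡1 y (V-mono y∈V) ¬L , λ t → old-in s̄<n (T⊆EL t) y∈V ¬L)
    (λ x x∈V ¬R → out≡1 x (V-mono x∈V) (¬R-mono (V⇒cell x∈V) ¬R) , λ t → old-out s̄<n (T⊆EL t) x∈V ¬R)

lemma10 : (p s k : ℕ) (ps ss : Fin k → ℕ)
    → 1 ≤ p → 1 ≤ k
    → (∀ i → ps i < p) → (∀ i → s ≤ ss i)
    → (n : ℕ) → 1 ≤ n → 2 * sbar p s ps ss ≤ n
    → ((T : Pred Edge 0ℓ) → CycleCover p s ps ss n T
         → LegalCover p s ps ss n (T ∖ Hook p s ps ss n))
      × ((T : Pred Edge 0ℓ) → LegalCover p s ps ss (suc n) T
         → LegalCover p s ps ss n (T ∖ New p s ps ss n))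
lemma10 p s k ps ss 1≤p _ ps<p s≤ss n 1≤n 2s̄≤n = hooks-removed n s̄<n , new-removed n s̄<n
  where
  open Covers p s ps ss 1≤p ps<p s≤ss
  s̄<n : s̄ < n
  s̄<n = half< 1≤n 2s̄≤n
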